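{- Let $\Gamma$ be a finite $(G,2)$-geodesic-transitive digraph of valency $r\geq 3$, where $G\leq\mathrm{Aut}(\Gamma)$, and let $(u,v)$ be an arc. Suppose that the induced subdigraph $[\Gamma^+(u)]$ is isomorphic to $k\Sigma$, where $k\geq 1$ and $\Sigma$ is a connected digraph with $|V(\Sigma)|\geq 3$. Then $|\Gamma^+(u)\cap\Gamma^+(v)|\neq 1$.
   Context: A digraph $\Gamma$ consists of a finite vertex set $V(\Gamma)$ with an antisymmetric irreflexive relation $\rightarrow$; an arc is an ordered pair $(u,v)$ with $u\rightarrow v$; $\Gamma^+(v)=\{w: v\rightarrow w\}$ and the valency is $|\Gamma^+(v)|$. For $U\subseteq V(\Gamma)$, $[U]$ is the induced subdigraph on $U$; $k\Sigma$ denotes the disjoint union of $k$ copies of $\Sigma$; connected means the underlying undirected graph is connected. The distance $d_\Gamma(u,v)$ is the length of a shortest directed path from $u$ to $v$. An $s$-arc is a sequence $(v_0,\dots,v_s)$ with $v_i\rightarrow v_{i+1}$ for all $i$; it is an $s$-geodesic if $d_\Gamma(v_0,v_s)=s$. $\Gamma$ is $(G,s)$-geodesic-transitive if $G$ is transitive on the set of $i$-geodesics for each $i\leq s$. -}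

module Defs where

open import Data.Nat using (ℕ; zero; suc; _<_)
open import Data.Bool using (Bool; true; false; _∨_; _∧_)
open import Data.Fin using (Fin; zero; suc; inject₁; fromℕ)
open import Data.Fin.Subset using (Subset; _∩_; ∣_∣)
open import Data.Fin.Permutation using (Permutation′; _⟨$⟩ʳ_; _∘ₚ_; flip)
import Data.Fin.Permutation as Perm
open import Data.Vec using (tabulate)
open import Data.Product using (Σ; ∃; ∃-syntax; _×_; _,_)
open import Relation.Binary.PropositionalEquality using (_≡_)
open import Relation.Nullary using (¬_)
open import Function.Definitions using (Injective)

record Digraph (n : ℕ) : Set where
  field
    adj     : Fin n → Fin n → Bool
    irrefl  : ∀ v → adj v v ≡ false
    antisym : ∀ u v → adj u v ≡ true → adj v u ≡ false
open Digraph public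

module _ {n : ℕ} (Γ : Digraph n) where

  Arc : Fin n → Fin n → Set
  Arc u v = adj Γ u v ≡ true

  outNbhd : Fin n → Subset n
  outNbhd v = tabulate (adj Γ v)

  outDegree : Fin n → ℕ
  outDegree v = ∣ outNbhd v ∣

  IsSArc : (s : ℕ) → (Fin (suc s) → Fin n) → Set
  IsSArc s p = ∀ (i : Fin s) → Arc (p (inject₁ i)) (p (suc i))

  PathOfLength : ℕ → Fin n → Fin n → Set
  PathOfLength s u v =
    Σ (Fin (suc s) → Fin n) λ p → IsSArc s p × p zero ≡ u × p (fromℕ s) ≡ v

  Distance : Fin n → Fin n → ℕ → Set
  Distance u v s = PathOfLength s u v × (∀ t → t < s → ¬ PathOfLength t u v)

  IsGeodesic : (s : ℕ) → (Fin (suc s) → Fin n) → Set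
  IsGeodesic s p = IsSArc s p × Distance (p zero) (p (fromℕ s)) s

  IsAutomorphism : Permutation′ n → Set
  IsAutomorphism g = ∀ u v → adj Γ (g ⟨$⟩ʳ u) (g ⟨$⟩ʳ v) ≡ adj Γ u v

  record IsAutSubgroup (G : Permutation′ n → Set) : Set where
    field
      auto    : ∀ g → G g → IsAutomorphism g
      has-id  : G Perm.id
      ∘-closed : ∀ g h → G g → G h → G (g ∘ₚ h)
      inv-closed : ∀ g → G g → G (flip g)
      resp-≈  : ∀ g h → (∀ x → g ⟨$⟩ʳ x ≡ h ⟨$⟩ʳ x) → G g → G h

  GeodesicTransitive : (Permutation′ n → Set) → ℕ → Set
  GeodesicTransitive G s =
    ∀ p q → IsGeodesic s p → IsGeodesic s q →
      ∃[ g ] (G g × ∀ i → g ⟨$⟩ʳ p i ≡ q i)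

  IsGeodesicTransitive : (Permutation′ n → Set) → ℕ → Set
  IsGeodesicTransitive G s = ∀ i → i Data.Nat.≤ s → GeodesicTransitive G i

  HasValency : ℕ → Set
  HasValency r = ∀ v → outDegree v ≡ r

module _ {m : ℕ} (Σ′ : Digraph m) where

  UEdge : Fin m → Fin m → Set
  UEdge a b = (adj Σ′ a b ∨ adj Σ′ b a) ≡ true

  Connected : Set
  Connected = ∀ a b → ∃[ t ] Σ (Fin (suc t) → Fin m) λ w →
    (∀ (i : Fin t) → UEdge (w (inject₁ i)) (w (suc i)))
      × w zero ≡ a × w (fromℕ t) ≡ b

kCopiesAdj : ∀ {m} (k : ℕ) → Digraph m → Fin k × Fin m → Fin k × Fin m → Bool
kCopiesAdj k Σ′ (i , a) (j , b) with i Data.Fin.≟ j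
... | Relation.Nullary.yes _ = adj Σ′ a b
... | Relation.Nullary.no _  = false

InducedOutIsoKCopies : ∀ {n m} → Digraph n → Fin n → ℕ → Digraph m → Set
InducedOutIsoKCopies {n} {m} Γ u k Σ′ =
  Σ (Fin k × Fin m → Fin n) λ φ →
      Injective _≡_ _≡_ φ
    × (∀ x → Arc Γ u (φ x))
    × (∀ w → Arc Γ u w → ∃[ x ] φ x ≡ w)
    × (∀ x y → adj Γ (φ x) (φ y) ≡ kCopiesAdj k Σ′ x y)

-- If |Γ⁺(u) ∩ Γ⁺(v)| = 1, arc-transitivity gives every arc (a , b) a unique common
-- out-neighbour c(a , b). With w = c(u , v) and x = c(u , w), the 2-geodesic (v , w , x)
-- has u as an in-neighbour of all its vertices, so by 2-geodesic-transitivity every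
-- 2-geodesic has such a dominating vertex. The map (a , b) ↦ (b , c(a , b)) on arcs is
-- then surjective, hence injective by finiteness: every arc has at most one common
-- in-neighbour. Valency ≥ 3 gives two out-neighbours y ≠ y′ of v outside Γ⁺(u); the
-- 2-geodesics (u , v , y) and (u , v , y′) then share their dominating vertex z, whence
-- y = c(z , v) = y′.
module Submission where

open import Defs
open import Data.Nat using (ℕ; suc; _+_; _<_; _≤_; _≥_; z≤n; s≤s; s≤s⁻¹)
open import Data.Nat.Properties using (+-suc; ≤-refl; +-mono-≤; +-monoˡ-≤; ≤-trans; ≤-reflexive; n<1+n)
open import Data.Bool using (true; false)
import Data.Bool as Bool
open import Data.Fin using (Fin; zero; suc; punchOut)
open import Data.Fin.Properties using (_≟_; punchOut-injective; <⇒notInjective; *↔×)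
open import Data.Fin.Subset using (Subset; _∈_; _∉_; _∩_; _─_; _-_; ⁅_⁆; ∣_∣; Nonempty)
open import Data.Fin.Subset.Properties
  using (nonempty?; Empty-unique; ∣⊥∣≡0; ∣⁅x⁆∣≡1; x∈⁅x⁆; x∈⁅y⁆⇒x≡y; p⊆q⇒∣p∣≤∣q∣;
         ∣p∩q∣≤∣q∣; x∈p∩q⁺; x∈p∩q⁻; x∈p∧x≢y⇒x∈p-y; drop-there; ∩-comm)
open import Data.Fin.Permutation using (Permutation′; _⟨$⟩ʳ_; _⟨$⟩ˡ_; inverseʳ)
open import Data.Vec using ([]; _∷_; lookup; here; there)
open import Data.Vec.Properties using (lookup∘tabulate; []=⇒lookup; lookup⇒[]=)
open import Data.Product using (∃; ∃₂; _×_; _,_; proj₁; proj₂)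
open import Function using (_∘_; _↔_; Inverse)
open import Function.Definitions using (Injective; StrictlySurjective)
open import Relation.Binary.PropositionalEquality
  using (_≡_; _≢_; refl; sym; trans; cong; subst; module ≡-Reasoning)
open import Relation.Nullary using (Dec; yes; no; ¬_; contradiction)

∣p∣≡∣p∩q∣+∣p─q∣ : ∀ {n} (p q : Subset n) → ∣ p ∣ ≡ ∣ p ∩ q ∣ + ∣ p ─ q ∣
∣p∣≡∣p∩q∣+∣p─q∣ []          []          = refl
∣p∣≡∣p∩q∣+∣p─q∣ (true  ∷ p) (true  ∷ q) = cong suc (∣p∣≡∣p∩q∣+∣p─q∣ p q)
∣p∣≡∣p∩q∣+∣p─q∣ (true  ∷ p) (false ∷ q) =
  trans (cong suc (∣p∣≡∣p∩q∣+∣p─q∣ p q)) (sym (+-suc _ _))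
∣p∣≡∣p∩q∣+∣p─q∣ (false ∷ p) (true  ∷ q) = ∣p∣≡∣p∩q∣+∣p─q∣ p q
∣p∣≡∣p∩q∣+∣p─q∣ (false ∷ p) (false ∷ q) = ∣p∣≡∣p∩q∣+∣p─q∣ p q

x∈p─q⁻ : ∀ {n} (p q : Subset n) {x} → x ∈ p ─ q → x ∈ p × x ∉ q
x∈p─q⁻ (true  ∷ p) (false ∷ q) here       = here , λ ()
x∈p─q⁻ (true  ∷ p) (true  ∷ q) {zero} ()
x∈p─q⁻ (false ∷ p) (true  ∷ q) {zero} ()
x∈p─q⁻ (false ∷ p) (false ∷ q) {zero} ()
x∈p─q⁻ (_    ∷ p) (_     ∷ q) {suc x} (there x∈) with x∈p─q⁻ p q x∈
... | x∈p , x∉q = there x∈p , x∉q ∘ drop-there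

x∈p⇒1≤∣p∣ : ∀ {n} {p : Subset n} {x} → x ∈ p → 1 ≤ ∣ p ∣
x∈p⇒1≤∣p∣ {p = p} {x} x∈p =
  subst (_≤ ∣ p ∣) (∣⁅x⁆∣≡1 x)
    (p⊆q⇒∣p∣≤∣q∣ (λ y∈⁅x⁆ → subst (_∈ p) (sym (x∈⁅y⁆⇒x≡y x y∈⁅x⁆)) x∈p))

1≤∣p∣⇒nonempty : ∀ {n} {p : Subset n} → 1 ≤ ∣ p ∣ → Nonempty p
1≤∣p∣⇒nonempty {n} {p} 1≤∣p∣ with nonempty? p
... | yes ne = ne
... | no ¬ne =
  contradiction (subst (1 ≤_) (trans (cong ∣_∣ (Empty-unique ¬ne)) (∣⊥∣≡0 n)) 1≤∣p∣) λ ()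

x∈p∧y∈p∧x≢y⇒2≤∣p∣ : ∀ {n} {p : Subset n} {x y} → x ∈ p → y ∈ p → x ≢ y → 2 ≤ ∣ p ∣
x∈p∧y∈p∧x≢y⇒2≤∣p∣ {p = p} {x} x∈p y∈p x≢y =
  subst (2 ≤_) (sym (∣p∣≡∣p∩q∣+∣p─q∣ p ⁅ x ⁆))
    (+-mono-≤ (x∈p⇒1≤∣p∣ (x∈p∩q⁺ (x∈p , x∈⁅x⁆ x)))
              (x∈p⇒1≤∣p∣ (x∈p∧x≢y⇒x∈p-y y∈p (x≢y ∘ sym))))

∣p∣≤1⇒x∈p⇒y∈p⇒x≡y : ∀ {n} {p : Subset n} {x y} → ∣ p ∣ ≤ 1 → x ∈ p → y ∈ p → x ≡ y
∣p∣≤1⇒x∈p⇒y∈p⇒x≡y {x = x} {y} ∣p∣≤1 x∈p y∈p with x ≟ y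
... | yes x≡y = x≡y
... | no  x≢y = contradiction (≤-trans (x∈p∧y∈p∧x≢y⇒2≤∣p∣ x∈p y∈p x≢y) ∣p∣≤1) λ { (s≤s ()) }

∣p∣≤1+∣p-x∣ : ∀ {n} (p : Subset n) x → ∣ p ∣ ≤ 1 + ∣ p - x ∣
∣p∣≤1+∣p-x∣ p x =
  subst (_≤ 1 + ∣ p - x ∣) (sym (∣p∣≡∣p∩q∣+∣p─q∣ p ⁅ x ⁆))
    (+-monoˡ-≤ ∣ p - x ∣ (subst (∣ p ∩ ⁅ x ⁆ ∣ ≤_) (∣⁅x⁆∣≡1 x) (∣p∩q∣≤∣q∣ p ⁅ x ⁆)))

2≤∣p∣⇒distinct-members : ∀ {n} {p : Subset n} → 2 ≤ ∣ p ∣ → ∃₂ λ x y → x ∈ p × y ∈ p × x ≢ y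
2≤∣p∣⇒distinct-members {p = p} 2≤∣p∣ with 1≤∣p∣⇒nonempty (≤-trans (s≤s z≤n) 2≤∣p∣)
... | x , x∈p with 1≤∣p∣⇒nonempty (s≤s⁻¹ (≤-trans 2≤∣p∣ (∣p∣≤1+∣p-x∣ p x)))
...   | y , y∈p-x with x∈p─q⁻ p ⁅ x ⁆ y∈p-x
...     | y∈p , y∉⁅x⁆ = x , y , x∈p , y∈p , λ { refl → y∉⁅x⁆ (x∈⁅x⁆ x) }

strictlySurjective⇒injective : ∀ {N} {f : Fin N → Fin N} →
  StrictlySurjective _≡_ f → Injective _≡_ _≡_ f
strictlySurjective⇒injective {suc N} {f} surj {p} {q} fp≡fq with p ≟ q
... | yes p≡q = p≡q
... | no  p≢q = contradiction (λ {y} {y′} → squeeze-injective {y} {y′}) (<⇒notInjective (n<1+n N))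
  where
  -- a preimage of y other than q: if surj returns q, then p serves as well
  preimage : ∀ y → ∃ λ x → q ≢ x × f x ≡ y
  preimage y with surj y
  ... | x , fx≡y with q ≟ x
  ...   | yes refl = p , p≢q ∘ sym , trans fp≡fq fx≡y
  ...   | no  q≢x  = x , q≢x , fx≡y

  q≢preimage : ∀ y → q ≢ proj₁ (preimage y)
  q≢preimage y = proj₁ (proj₂ (preimage y))

  squeeze : Fin (suc N) → Fin N
  squeeze y = punchOut (q≢preimage y)

  squeeze-injective : Injective _≡_ _≡_ squeeze
  squeeze-injective {y} {y′} eq = begin
    y                        ≡⟨ sym (proj₂ (proj₂ (preimage y))) ⟩
    f (proj₁ (preimage y))   ≡⟨ cong f (punchOut-injective (q≢preimage y) (q≢preimage y′) eq) ⟩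
    f (proj₁ (preimage y′))  ≡⟨ proj₂ (proj₂ (preimage y′)) ⟩
    y′                       ∎
    where open ≡-Reasoning

finite-strictlySurjective⇒injective : ∀ {a} {A : Set a} {N} → Fin N ↔ A → {f : A → A} →
  StrictlySurjective _≡_ f → Injective _≡_ _≡_ f
finite-strictlySurjective⇒injective {N = N} Fin↔A {f} surj {x} {y} fx≡fy = begin
  x             ≡⟨ sym (strictlyInverseˡ x) ⟩
  to (from x)   ≡⟨ cong to (strictlySurjective⇒injective F-surjective F[from-x]≡F[from-y]) ⟩
  to (from y)   ≡⟨ strictlyInverseˡ y ⟩
  y             ∎
  where
  open ≡-Reasoning
  open Inverse Fin↔A

  F : Fin N → Fin N
  F = from ∘ f ∘ to

  F∘from : ∀ z → F (from z) ≡ from (f z)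
  F∘from z = cong (from ∘ f) (strictlyInverseˡ z)

  F-surjective : StrictlySurjective _≡_ F
  F-surjective i with surj (to i)
  ... | z , fz≡to-i = from z , trans (F∘from z) (trans (cong from fz≡to-i) (strictlyInverseʳ i))

  F[from-x]≡F[from-y] : F (from x) ≡ F (from y)
  F[from-x]≡F[from-y] = trans (F∘from x) (trans (cong from fx≡fy) (sym (F∘from y)))

module _ {n : ℕ} (Γ : Digraph n) where

  Arc? : ∀ a b → Dec (Arc Γ a b)
  Arc? a b = adj Γ a b Bool.≟ true

  adj≡false⇒¬Arc : ∀ {a b} → adj Γ a b ≡ false → ¬ Arc Γ a b
  adj≡false⇒¬Arc a↛b a→b = contradiction (trans (sym a→b) a↛b) λ ()

  Arc-irrefl : ∀ {a} → ¬ Arc Γ a a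
  Arc-irrefl {a} = adj≡false⇒¬Arc (irrefl Γ a)

  Arc-asym : ∀ {a b} → Arc Γ a b → ¬ Arc Γ b a
  Arc-asym {a} {b} a→b = adj≡false⇒¬Arc (antisym Γ a b a→b)

  Arc⇒≢ : ∀ {a b} → Arc Γ a b → a ≢ b
  Arc⇒≢ a→b refl = Arc-irrefl a→b

  ∈outNbhd⇒Arc : ∀ {a b} → b ∈ outNbhd Γ a → Arc Γ a b
  ∈outNbhd⇒Arc {a} {b} b∈ = trans (sym (lookup∘tabulate (adj Γ a) b)) ([]=⇒lookup b∈)

  Arc⇒∈outNbhd : ∀ {a b} → Arc Γ a b → b ∈ outNbhd Γ a
  Arc⇒∈outNbhd {a} {b} a→b = lookup⇒[]= b _ (trans (lookup∘tabulate (adj Γ a) b) a→b)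

  CommonOut : Fin n → Fin n → Fin n → Set
  CommonOut a b c = Arc Γ a c × Arc Γ b c

  CommonIn : Fin n → Fin n → Fin n → Set
  CommonIn a b z = Arc Γ z a × Arc Γ z b

  Dominator : ∀ {s} → (Fin s → Fin n) → Fin n → Set
  Dominator p z = ∀ i → Arc Γ z (p i)

  arc⇒1-geodesic : ∀ {a b} → Arc Γ a b → IsGeodesic Γ 1 (lookup (a ∷ b ∷ []))
  arc⇒1-geodesic {a} {b} a→b = 1-arc , (lookup (a ∷ b ∷ []) , 1-arc , refl , refl) , shorter
    where
    1-arc : IsSArc Γ 1 (lookup (a ∷ b ∷ []))
    1-arc zero = a→b

    shorter : ∀ t → t < 1 → ¬ PathOfLength Γ t a b
    shorter 0 _ (_ , _ , refl , p0≡b) = Arc⇒≢ a→b p0≡b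
    shorter (suc _) (s≤s ())

  2-arc-ends-distinct : ∀ {a b c} → Arc Γ a b → Arc Γ b c → a ≢ c
  2-arc-ends-distinct a→b b→c refl = Arc-asym a→b b→c

  2-arc⇒2-geodesic : ∀ {a b c} → Arc Γ a b → Arc Γ b c → ¬ Arc Γ a c →
    IsGeodesic Γ 2 (lookup (a ∷ b ∷ c ∷ []))
  2-arc⇒2-geodesic {a} {b} {c} a→b b→c a↛c =
    2-arc , (lookup (a ∷ b ∷ c ∷ []) , 2-arc , refl , refl) , shorter
    where
    2-arc : IsSArc Γ 2 (lookup (a ∷ b ∷ c ∷ []))
    2-arc zero       = a→b
    2-arc (suc zero) = b→c

    shorter : ∀ t → t < 2 → ¬ PathOfLength Γ t a c
    shorter 0 _ (_ , _ , refl , p0≡c)     = 2-arc-ends-distinct a→b b→c p0≡c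
    shorter 1 _ (_ , arc , refl , refl)   = a↛c (arc zero)
    shorter (suc (suc _)) (s≤s (s≤s ()))

  ∈∩⇒CommonOut : ∀ {a b c} → c ∈ outNbhd Γ a ∩ outNbhd Γ b → CommonOut a b c
  ∈∩⇒CommonOut {a} {b} c∈ with x∈p∩q⁻ (outNbhd Γ a) (outNbhd Γ b) c∈
  ... | c∈Γ⁺a , c∈Γ⁺b = ∈outNbhd⇒Arc c∈Γ⁺a , ∈outNbhd⇒Arc c∈Γ⁺b

  CommonOut⇒∈∩ : ∀ {a b c} → CommonOut a b c → c ∈ outNbhd Γ a ∩ outNbhd Γ b
  CommonOut⇒∈∩ (a→c , b→c) = x∈p∩q⁺ (Arc⇒∈outNbhd a→c , Arc⇒∈outNbhd b→c)

  ∣Γ⁺a∩Γ⁺b∣≡1⇒∃!CommonOut : ∀ {a b} → ∣ outNbhd Γ a ∩ outNbhd Γ b ∣ ≡ 1 →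
    ∃ (CommonOut a b) × (∀ {c c′} → CommonOut a b c → CommonOut a b c′ → c ≡ c′)
  ∣Γ⁺a∩Γ⁺b∣≡1⇒∃!CommonOut ∣Γ⁺a∩Γ⁺b∣≡1 with 1≤∣p∣⇒nonempty (≤-reflexive (sym ∣Γ⁺a∩Γ⁺b∣≡1))
  ... | c , c∈ = (c , ∈∩⇒CommonOut c∈) , λ c-common c′-common →
    ∣p∣≤1⇒x∈p⇒y∈p⇒x≡y (≤-reflexive ∣Γ⁺a∩Γ⁺b∣≡1) (CommonOut⇒∈∩ c-common) (CommonOut⇒∈∩ c′-common)

  two-out-neighbours-outside : ∀ {a b} → 3 ≤ outDegree Γ b → ∣ outNbhd Γ a ∩ outNbhd Γ b ∣ ≡ 1 →
    ∃₂ λ y y′ → (Arc Γ b y × ¬ Arc Γ a y) × (Arc Γ b y′ × ¬ Arc Γ a y′) × y ≢ y′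
  two-out-neighbours-outside {a} {b} 3≤∣Γ⁺b∣ ∣Γ⁺a∩Γ⁺b∣≡1
    with 2≤∣p∣⇒distinct-members 2≤∣Γ⁺b─Γ⁺a∣
    where
    ∣Γ⁺b∩Γ⁺a∣≡1 : ∣ outNbhd Γ b ∩ outNbhd Γ a ∣ ≡ 1
    ∣Γ⁺b∩Γ⁺a∣≡1 = trans (cong ∣_∣ (∩-comm (outNbhd Γ b) (outNbhd Γ a))) ∣Γ⁺a∩Γ⁺b∣≡1

    ∣Γ⁺b∣≡1+∣Γ⁺b─Γ⁺a∣ : ∣ outNbhd Γ b ∣ ≡ 1 + ∣ outNbhd Γ b ─ outNbhd Γ a ∣
    ∣Γ⁺b∣≡1+∣Γ⁺b─Γ⁺a∣ = trans (∣p∣≡∣p∩q∣+∣p─q∣ (outNbhd Γ b) (outNbhd Γ a))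
                              (cong (_+ ∣ outNbhd Γ b ─ outNbhd Γ a ∣) ∣Γ⁺b∩Γ⁺a∣≡1)

    2≤∣Γ⁺b─Γ⁺a∣ : 2 ≤ ∣ outNbhd Γ b ─ outNbhd Γ a ∣
    2≤∣Γ⁺b─Γ⁺a∣ = s≤s⁻¹ (subst (3 ≤_) ∣Γ⁺b∣≡1+∣Γ⁺b─Γ⁺a∣ 3≤∣Γ⁺b∣)
  ... | y , y′ , y∈ , y′∈ , y≢y′ = y , y′ , outside y∈ , outside y′∈ , y≢y′
    where
    outside : ∀ {y} → y ∈ outNbhd Γ b ─ outNbhd Γ a → Arc Γ b y × ¬ Arc Γ a y
    outside y∈ with x∈p─q⁻ (outNbhd Γ b) (outNbhd Γ a) y∈
    ... | y∈Γ⁺b , y∉Γ⁺a = ∈outNbhd⇒Arc y∈Γ⁺b , y∉Γ⁺a ∘ Arc⇒∈outNbhd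

module _ {n : ℕ} (Γ : Digraph n)
  (commonOut : ∀ {a b} → Arc Γ a b → ∃ (CommonOut Γ a b))
  (commonOut-unique : ∀ {a b c c′} → Arc Γ a b →
                      CommonOut Γ a b c → CommonOut Γ a b c′ → c ≡ c′)
  where

  dominated-2-geodesic : ∀ {u v} → Arc Γ u v →
    ∃₂ λ (p : Fin 3 → Fin n) z → IsGeodesic Γ 2 p × Dominator Γ p z
  dominated-2-geodesic {u} {v} u→v with commonOut u→v
  ... | w , u→w , v→w with commonOut u→w
  ...   | x , u→x , w→x = lookup (v ∷ w ∷ x ∷ []) , u , 2-arc⇒2-geodesic Γ v→w w→x v↛x , u⇒vwx
    where
    v↛x : ¬ Arc Γ v x
    v↛x v→x = Arc-irrefl Γ (subst (Arc Γ w) (commonOut-unique u→v (u→x , v→x) (u→w , v→w)) w→x)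

    u⇒vwx : Dominator Γ (lookup (v ∷ w ∷ x ∷ [])) u
    u⇒vwx zero             = u→v
    u⇒vwx (suc zero)       = u→w
    u⇒vwx (suc (suc zero)) = u→x

  -- the identity off the arcs, so that finiteness of Fin n × Fin n can be used
  shift : Fin n × Fin n → Fin n × Fin n
  shift (a , b) with Arc? Γ a b
  ... | yes a→b = b , proj₁ (commonOut a→b)
  ... | no  _   = a , b

  shift-arc : ∀ {a b c} → Arc Γ a b → CommonOut Γ a b c → shift (a , b) ≡ (b , c)
  shift-arc {a} {b} a→b c-common with Arc? Γ a b
  ... | yes a→b′ = cong (b ,_) (commonOut-unique a→b′ (proj₂ (commonOut a→b′)) c-common)
  ... | no  a↛b  = contradiction a→b a↛b

  shift-non-arc : ∀ {a b} → ¬ Arc Γ a b → shift (a , b) ≡ (a , b)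
  shift-non-arc {a} {b} a↛b with Arc? Γ a b
  ... | yes a→b = contradiction a→b a↛b
  ... | no  _   = refl

  module _ (commonIn : ∀ {a b} → Arc Γ a b → ∃ (CommonIn Γ a b)) where

    commonIn-unique : ∀ {a b z z′} → Arc Γ a b → CommonIn Γ a b z → CommonIn Γ a b z′ → z ≡ z′
    commonIn-unique a→b (z→a , z→b) (z′→a , z′→b) =
      cong proj₁ (finite-strictlySurjective⇒injective *↔× shift-surjective
        (trans (shift-arc z→a (z→b , a→b)) (sym (shift-arc z′→a (z′→b , a→b)))))
      where
      shift-surjective : StrictlySurjective _≡_ shift
      shift-surjective (a , b) with Arc? Γ a b
      ... | yes a→b = let (z , z→a , z→b) = commonIn a→b in (z , a) , shift-arc z→a (z→b , a→b)
      ... | no  a↛b = (a , b) , shift-non-arc a↛b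

    2-geodesic-extension-unique :
      (∀ (p : Fin 3 → Fin n) → IsGeodesic Γ 2 p → ∃ (Dominator Γ p)) →
      ∀ {a b y y′} → Arc Γ a b → Arc Γ b y → ¬ Arc Γ a y → Arc Γ b y′ → ¬ Arc Γ a y′ → y ≡ y′
    2-geodesic-extension-unique dominated {a} {b} {y} {y′} a→b b→y a↛y b→y′ a↛y′
      with dominated (lookup (a ∷ b ∷ y ∷ [])) (2-arc⇒2-geodesic Γ a→b b→y a↛y)
         | dominated (lookup (a ∷ b ∷ y′ ∷ [])) (2-arc⇒2-geodesic Γ a→b b→y′ a↛y′)
    ... | z , z⇒aby | z′ , z′⇒aby′ =
      commonOut-unique z→b (z⇒aby (suc (suc zero)) , b→y) (z→y′ , b→y′)
      where
      z≡z′ : z ≡ z′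
      z≡z′ = commonIn-unique a→b (z⇒aby zero , z⇒aby (suc zero)) (z′⇒aby′ zero , z′⇒aby′ (suc zero))

      z→b : Arc Γ z b
      z→b = z⇒aby (suc zero)

      z→y′ : Arc Γ z y′
      z→y′ = subst (λ t → Arc Γ t y′) (sym z≡z′) (z′⇒aby′ (suc (suc zero)))

module _ {n : ℕ} {Γ : Digraph n} {G : Permutation′ n → Set} (G≤Aut : IsAutSubgroup Γ G) where

  open IsAutSubgroup G≤Aut

  Arc-image : ∀ {g a b} → G g → Arc Γ a b → Arc Γ (g ⟨$⟩ʳ a) (g ⟨$⟩ʳ b)
  Arc-image {g} {a} {b} g∈G = trans (auto g g∈G a b)

  Arc-preimage : ∀ {g a b} → G g → Arc Γ (g ⟨$⟩ʳ a) b → Arc Γ a (g ⟨$⟩ˡ b)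
  Arc-preimage {g} {a} {b} g∈G ga→b =
    trans (sym (auto g g∈G a (g ⟨$⟩ˡ b))) (subst (Arc Γ (g ⟨$⟩ʳ a)) (sym (inverseʳ g)) ga→b)

  ∃CommonOut-image : ∀ {g a b} → G g → ∃ (CommonOut Γ a b) → ∃ (CommonOut Γ (g ⟨$⟩ʳ a) (g ⟨$⟩ʳ b))
  ∃CommonOut-image {g} g∈G (c , a→c , b→c) = g ⟨$⟩ʳ c , Arc-image g∈G a→c , Arc-image g∈G b→c

  ∃CommonIn-image : ∀ {g a b} → G g → ∃ (CommonIn Γ a b) → ∃ (CommonIn Γ (g ⟨$⟩ʳ a) (g ⟨$⟩ʳ b))
  ∃CommonIn-image {g} g∈G (z , z→a , z→b) = g ⟨$⟩ʳ z , Arc-image g∈G z→a , Arc-image g∈G z→b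

  CommonOut-unique-image : ∀ {g a b} → G g →
    (∀ {c c′} → CommonOut Γ a b c → CommonOut Γ a b c′ → c ≡ c′) →
    (∀ {c c′} → CommonOut Γ (g ⟨$⟩ʳ a) (g ⟨$⟩ʳ b) c → CommonOut Γ (g ⟨$⟩ʳ a) (g ⟨$⟩ʳ b) c′ → c ≡ c′)
  CommonOut-unique-image {g} g∈G unique {c} {c′} (ga→c , gb→c) (ga→c′ , gb→c′) = begin
    c                      ≡⟨ sym (inverseʳ g) ⟩
    g ⟨$⟩ʳ (g ⟨$⟩ˡ c)      ≡⟨ cong (g ⟨$⟩ʳ_) (unique (Arc-preimage g∈G ga→c , Arc-preimage g∈G gb→c)
                                                  (Arc-preimage g∈G ga→c′ , Arc-preimage g∈G gb→c′)) ⟩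
    g ⟨$⟩ʳ (g ⟨$⟩ˡ c′)     ≡⟨ inverseʳ g ⟩
    c′                     ∎
    where open ≡-Reasoning

  arc-transitive : GeodesicTransitive Γ G 1 →
    ∀ {a b c d} → Arc Γ a b → Arc Γ c d → ∃ λ g → G g × g ⟨$⟩ʳ a ≡ c × g ⟨$⟩ʳ b ≡ d
  arc-transitive transitive {a} {b} {c} {d} a→b c→d
    with transitive (lookup (a ∷ b ∷ [])) (lookup (c ∷ d ∷ []))
                    (arc⇒1-geodesic Γ a→b) (arc⇒1-geodesic Γ c→d)
  ... | g , g∈G , g∘p≡q = g , g∈G , g∘p≡q zero , g∘p≡q (suc zero)

  arc-transitive-spread : GeodesicTransitive Γ G 1 → (P : Fin n → Fin n → Set) →
    (∀ {g a b} → G g → P a b → P (g ⟨$⟩ʳ a) (g ⟨$⟩ʳ b)) →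
    ∀ {u v} → Arc Γ u v → P u v → ∀ {a b} → Arc Γ a b → P a b
  arc-transitive-spread transitive P invariant u→v Puv a→b
    with arc-transitive transitive u→v a→b
  ... | g , g∈G , refl , refl = invariant g∈G Puv

  dominated-spread : ∀ {s} → GeodesicTransitive Γ G s →
    ∀ {p q} → IsGeodesic Γ s p → ∃ (Dominator Γ p) → IsGeodesic Γ s q → ∃ (Dominator Γ q)
  dominated-spread transitive {p} {q} p-geodesic (z , z⇒p) q-geodesic
    with transitive p q p-geodesic q-geodesic
  ... | g , g∈G , g∘p≡q = g ⟨$⟩ʳ z , λ i → subst (Arc Γ _) (g∘p≡q i) (Arc-image g∈G (z⇒p i))

lemma4p4 : {n : ℕ} (Γ : Digraph n) (G : Permutation′ n → Set) (r : ℕ) →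
    IsAutSubgroup Γ G → IsGeodesicTransitive Γ G 2 →
    HasValency Γ r → r ≥ 3 →
    (u v : Fin n) → Arc Γ u v →
    (k m : ℕ) (Σ′ : Digraph m) → k ≥ 1 → Connected Σ′ → m ≥ 3 →
    InducedOutIsoKCopies Γ u k Σ′ →
    ∣ outNbhd Γ u ∩ outNbhd Γ v ∣ ≢ 1
lemma4p4 Γ G r G≤Aut geodesic-transitive valency r≥3 u v u→v _ _ _ _ _ _ _ ∣Γ⁺u∩Γ⁺v∣≡1
  with two-out-neighbours-outside Γ (subst (3 ≤_) (sym (valency v)) r≥3) ∣Γ⁺u∩Γ⁺v∣≡1
     | ∣Γ⁺a∩Γ⁺b∣≡1⇒∃!CommonOut Γ ∣Γ⁺u∩Γ⁺v∣≡1
... | y , y′ , (v→y , u↛y) , (v→y′ , u↛y′) , y≢y′ | (c , u→c , v→c) , uv-unique =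
  y≢y′ (2-geodesic-extension-unique Γ commonOut commonOut-unique commonIn dominated
          u→v v→y u↛y v→y′ u↛y′)
  where
  arc-transitivity : GeodesicTransitive Γ G 1
  arc-transitivity = geodesic-transitive 1 (s≤s z≤n)

  commonOut : ∀ {a b} → Arc Γ a b → ∃ (CommonOut Γ a b)
  commonOut = arc-transitive-spread G≤Aut arc-transitivity
    (λ a b → ∃ (CommonOut Γ a b)) (∃CommonOut-image G≤Aut) u→v (c , u→c , v→c)

  commonOut-unique : ∀ {a b c c′} → Arc Γ a b → CommonOut Γ a b c → CommonOut Γ a b c′ → c ≡ c′
  commonOut-unique a→b =
    arc-transitive-spread G≤Aut arc-transitivity
      (λ a b → ∀ {c c′} → CommonOut Γ a b c → CommonOut Γ a b c′ → c ≡ c′)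
      (CommonOut-unique-image G≤Aut) u→v uv-unique a→b

  commonIn : ∀ {a b} → Arc Γ a b → ∃ (CommonIn Γ a b)
  commonIn = arc-transitive-spread G≤Aut arc-transitivity
    (λ a b → ∃ (CommonIn Γ a b)) (∃CommonIn-image G≤Aut) v→c (u , u→v , u→c)

  dominated : ∀ p → IsGeodesic Γ 2 p → ∃ (Dominator Γ p)
  dominated p p-geodesic with dominated-2-geodesic Γ commonOut commonOut-unique u→v
  ... | q , z , q-geodesic , z⇒q =
    dominated-spread G≤Aut (geodesic-transitive 2 ≤-refl) q-geodesic (z , z⇒q) p-geodesic
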